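{- Let $h \geq 2$. Let $X$ be a countably infinite set, and let $\mathcal{A}^* = (\mathcal{A}_1,\ldots,\mathcal{A}_h)$ be an $h$-tuple of sets of finite subsets of $X$. For every subset $S$ of $X$, let $g_{\mathcal{A}^*}(S)$ be the number of $h$-tuples $(A_1,\ldots,A_h) \in \mathcal{A}_1 \times \cdots \times \mathcal{A}_h$ such that $A_i \cap A_j = \emptyset$ for $1 \leq i < j \leq h$ and $S = \bigcup_{i=1}^h A_i$. Let $W$ be an infinite set of positive integers such that for every $n \in W$, one has $g_{\mathcal{A}^*}(S) \geq 2$ for all but finitely many sets $S \in [X]^n$. Then for every integer $n$ there is a finite subset $S$ of $X$ with $g_{\mathcal{A}^*}(S) \geq n$.
   Context: For a set $X$ and a nonnegative integer $k$, $[X]^k$ denotes the set of all subsets of $X$ of cardinality $k$. -}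

module Defs where

open import Data.Nat using (ℕ; _<_; _≤_; _≥_)
open import Data.Fin as F using (Fin)
open import Data.List using (List; length)
open import Data.List.Membership.Propositional using (_∈_)
open import Data.List.Relation.Unary.Linked using (Linked)
open import Data.List.Relation.Unary.Any using (Any)
open import Data.List.Relation.Unary.All using (All)
open import Data.Vec using (Vec; lookup)
open import Data.Product using (Σ; ∃; ∃-syntax; _×_)
open import Data.Empty using (⊥)
open import Relation.Nullary using (¬_)
open import Relation.Binary.PropositionalEquality using (_≡_)
open import Function.Definitions using (Injective)

-- The countably infinite set X is taken to be ℕ.
-- A finite subset of ℕ is represented canonically by the strictly
-- increasing list of its elements (so equal sets = equal lists).
FinSubset : List ℕ → Set
FinSubset xs = Linked _<_ xs

InLayer : ℕ → List ℕ → Set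
InLayer n S = FinSubset S × length S ≡ n

Family : Set₁
Family = List ℕ → Set

Disjoint : List ℕ → List ℕ → Set
Disjoint A B = ∀ x → x ∈ A → x ∈ B → ⊥

IsRep : (h : ℕ) → (Fin h → Family) → List ℕ → Vec (List ℕ) h → Set
IsRep h 𝒜 S t =
    (∀ i → FinSubset (lookup t i))
  × (∀ i → 𝒜 i (lookup t i))
  × (∀ i j → i F.< j → Disjoint (lookup t i) (lookup t j))
  × (∀ x → (x ∈ S → ∃[ i ] x ∈ lookup t i) × (∀ i → x ∈ lookup t i → x ∈ S))

g≥ : (h : ℕ) → (Fin h → Family) → List ℕ → ℕ → Set
g≥ h 𝒜 S n = Σ (Fin n → Vec (List ℕ) h) λ t → Injective _≡_ _≡_ t × (∀ k → IsRep h 𝒜 S (t k))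

Infinite : (ℕ → Set) → Set
Infinite W = ∀ m → ∃[ n ] (m ≤ n × W n)

AlmostAllLayer≥2 : (h : ℕ) → (Fin h → Family) → ℕ → Set
AlmostAllLayer≥2 h 𝒜 n =
  ∃[ E ] (∀ S → InLayer n S → ¬ (S ∈ E) → g≥ h 𝒜 S 2)

{-# OPTIONS --safe #-}
module Submission where

-- Fix m ∈ W with m ≥ 2n and colour every m-subset S of ℕ lying above the finitely many exceptional
-- sets by a pair (p, q) of distinct words over {1,…,h} of length m, each recording for the elements
-- of S in increasing order which part of a representation of S they belong to. By Ramsey's theorem
-- some large set Z has all its m-subsets of the same colour (p, q). Choose T ⊆ Z with 2m elements,
-- separated in Z by gaps of at least m elements: any Q ⊆ T with |Q| = count i p extends inside Z to an
-- m-set S in which Q is exactly the part of S that p assigns to i, so 𝒜ᵢ contains every subset of T of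
-- that size, and likewise for q. Hence every rearrangement of p gives a representation of the first m
-- elements of T, and a non-constant word of length ≥ 2n has at least n rearrangements. If p and q
-- are constant words αᵐ and βᵐ, the rearrangements of αᵐβᵐ represent T itself.

open import Data.Nat as ℕ using (ℕ; zero; suc; _+_; _*_; _≤_; _<_; _≥_; z≤n; s≤s; _<?_; _≤?_)
open import Data.Nat.Properties
open import Data.Nat.ListAction using (sum)
open import Data.Fin as F using (Fin; toℕ)
open import Data.Fin.Properties as F using (toℕ-injective; toℕ<n)
open import Data.List using (List; []; _∷_; _++_; length; filter; replicate; take; drop; map; concat; allFin; applyUpTo; cartesianProduct; cartesianProductWith)
open import Data.List.Properties as List using (length-++; ++-assoc; ++-identityʳ; ∷-injectiveˡ; ∷-injectiveʳ; length-replicate; length-take; take++drop≡id; length-applyUpTo; filter-none; filter-++)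
open import Data.List.Membership.Propositional using (_∈_; _∉_)
open import Data.List.Membership.Propositional.Properties using (∈-cartesianProductWith⁺; ∈-cartesianProduct⁺; ∈-allFin; ∈-concat⁺′)
open import Data.List.Extrema.Nat using (max; xs≤max)
open import Data.List.Relation.Unary.Any using (here; there)
open import Data.List.Relation.Unary.All as All using (All; []; _∷_)
import Data.List.Relation.Unary.All.Properties as All
open import Data.List.Relation.Unary.AllPairs using (AllPairs; []; _∷_)
open import Data.List.Relation.Unary.Linked as Linked using (Linked; linked?)
import Data.List.Relation.Unary.Linked.Properties as Linked
open import Data.List.Relation.Unary.Linked.Properties using (Linked⇒AllPairs; AllPairs⇒Linked)
open import Data.List.Relation.Binary.Sublist.Propositional as Sublist using (_⊆_; []; _∷_; _∷ʳ_; ⊆-refl; ⊆-trans)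
open import Data.List.Relation.Binary.Sublist.Propositional.Properties using (All-resp-⊆; take-⊆; ++⁺ˡ; length-mono-≤)
open import Data.List.Relation.Binary.Permutation.Propositional using (_↭_; ↭-refl; ↭-prep; ↭-sym; ↭-trans; ↭-reflexive)
open import Data.List.Relation.Binary.Permutation.Propositional.Properties using (shift; ++-comm; All-resp-↭; ↭-length; filter-↭)
open import Data.Vec using (Vec; lookup; tabulate)
open import Data.Vec.Properties using (lookup∘tabulate; tabulate∘lookup; tabulate-cong)
open import Data.Product using (Σ; ∃-syntax; _×_; _,_; proj₁; proj₂; uncurry)
import Data.Product.Properties as Σ
open import Data.Sum using (_⊎_; inj₁; inj₂)
open import Data.Empty using (⊥-elim)
open import Function using (_∘′_)
open import Function.Definitions using (Injective)
open import Relation.Nullary using (yes; no; Dec)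
open import Relation.Nullary.Decidable using (_×-dec_)
open import Relation.Binary.Definitions using (DecidableEquality; tri<; tri≈; tri>)
open import Relation.Binary.PropositionalEquality
open import Defs

variable
  A : Set
  x : ℕ
  xs ys : List ℕ

-- Strictly increasing lists

AllPairs-resp-⊆ : ∀ {R : A → A → Set} {xs ys : List A} → xs ⊆ ys → AllPairs R ys → AllPairs R xs
AllPairs-resp-⊆ [] [] = []
AllPairs-resp-⊆ (_ ∷ʳ τ) (_ ∷ rys) = AllPairs-resp-⊆ τ rys
AllPairs-resp-⊆ (refl ∷ τ) (ry ∷ rys) = All-resp-⊆ τ ry ∷ AllPairs-resp-⊆ τ rys

Linked-resp-⊆ : xs ⊆ ys → Linked _<_ ys → Linked _<_ xs
Linked-resp-⊆ τ = AllPairs⇒Linked ∘′ AllPairs-resp-⊆ τ ∘′ Linked⇒AllPairs <-trans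

head<tail : Linked _<_ (x ∷ xs) → All (x <_) xs
head<tail l with Linked⇒AllPairs <-trans l
... | x<xs ∷ _ = x<xs

head∉tail : Linked _<_ (x ∷ xs) → x ∉ xs
head∉tail l x∈xs = <-irrefl refl (All.lookup (head<tail l) x∈xs)

sorted-extensional : Linked _<_ xs → Linked _<_ ys →
                     (∀ {z} → z ∈ xs → z ∈ ys) → (∀ {z} → z ∈ ys → z ∈ xs) → xs ≡ ys
sorted-extensional {[]} {[]} _ _ _ _ = refl
sorted-extensional {[]} {y ∷ ys} _ _ _ ys⊆ with ys⊆ (here refl)
... | ()
sorted-extensional {x ∷ xs} {[]} _ _ xs⊆ _ with xs⊆ (here refl)
... | ()
sorted-extensional {x ∷ xs} {y ∷ ys} lx ly xs⊆ ys⊆ =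
  cong₂ _∷_ x≡y (sorted-extensional (Linked.tail lx) (Linked.tail ly) (tail-⊆ x≡y lx xs⊆) (tail-⊆ (sym x≡y) ly ys⊆))
  where
  x≡y : x ≡ y
  x≡y with xs⊆ (here refl) | ys⊆ (here refl)
  ... | here x≡y | _ = x≡y
  ... | there _ | here y≡x = sym y≡x
  ... | there x∈ys | there y∈xs = ⊥-elim (<-asym (All.lookup (head<tail lx) y∈xs) (All.lookup (head<tail ly) x∈ys))
  tail-⊆ : ∀ {x y xs ys} → x ≡ y → Linked _<_ (x ∷ xs) → (∀ {z} → z ∈ x ∷ xs → z ∈ y ∷ ys) →
           ∀ {z} → z ∈ xs → z ∈ ys
  tail-⊆ refl lx xs⊆ z∈xs with xs⊆ (there z∈xs)
  ... | here refl = ⊥-elim (head∉tail lx z∈xs)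
  ... | there z∈ys = z∈ys

-- Words and representations

module _ {h : ℕ} where

  part : List (Fin h) → Fin h → List ℕ → List ℕ
  part (c ∷ p) i (x ∷ S) with c F.≟ i
  ... | yes _ = x ∷ part p i S
  ... | no _ = part p i S
  part _ _ _ = []

  count : Fin h → List (Fin h) → ℕ
  count i p = length (filter (F._≟ i) p)

  part-accept : ∀ {c i : Fin h} p x S → c ≡ i → part (c ∷ p) i (x ∷ S) ≡ x ∷ part p i S
  part-accept {c} {i} p x S c≡i with c F.≟ i
  ... | yes _ = refl
  ... | no c≢i = ⊥-elim (c≢i c≡i)

  part-reject : ∀ {c i : Fin h} p x S → c ≢ i → part (c ∷ p) i (x ∷ S) ≡ part p i S
  part-reject {c} {i} p x S c≢i with c F.≟ i
  ... | yes c≡i = ⊥-elim (c≢i c≡i)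
  ... | no _ = refl

  part-⊆ : ∀ p i S → part p i S ⊆ S
  part-⊆ [] i S = Sublist.minimum S
  part-⊆ (c ∷ p) i [] = []
  part-⊆ (c ∷ p) i (x ∷ S) with c F.≟ i
  ... | yes _ = refl ∷ part-⊆ p i S
  ... | no _ = x ∷ʳ part-⊆ p i S

  ∈-part⁻ : ∀ p i S {z} → z ∈ part p i S → z ∈ S
  ∈-part⁻ p i S = Sublist.lookup (part-⊆ p i S)

  length-part : ∀ p i S → length p ≡ length S → length (part p i S) ≡ count i p
  length-part [] i [] _ = refl
  length-part (c ∷ p) i (x ∷ S) eq with c F.≟ i
  ... | yes _ = cong suc (length-part p i S (suc-injective eq))
  ... | no _ = length-part p i S (suc-injective eq)

  part-disjoint : ∀ p {i j S z} → Linked _<_ S → z ∈ part p i S → z ∈ part p j S → i ≡ j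
  part-disjoint (c ∷ p) {i} {j} {x ∷ S} l z∈i z∈j with c F.≟ i | c F.≟ j | z∈i | z∈j
  ... | yes c≡i | yes c≡j | _ | _ = trans (sym c≡i) c≡j
  ... | yes _ | no _ | here refl | z∈j′ = ⊥-elim (head∉tail l (∈-part⁻ p j S z∈j′))
  ... | yes _ | no _ | there z∈i′ | z∈j′ = part-disjoint p (Linked.tail l) z∈i′ z∈j′
  ... | no _ | yes _ | z∈i′ | here refl = ⊥-elim (head∉tail l (∈-part⁻ p i S z∈i′))
  ... | no _ | yes _ | z∈i′ | there z∈j′ = part-disjoint p (Linked.tail l) z∈i′ z∈j′
  ... | no _ | no _ | z∈i′ | z∈j′ = part-disjoint p (Linked.tail l) z∈i′ z∈j′

  ∈-part-head : ∀ c p x S → x ∈ part (c ∷ p) c (x ∷ S)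
  ∈-part-head c p x S = subst (x ∈_) (sym (part-accept {c} p x S refl)) (here refl)

  part-cover : ∀ p S {z} → length p ≡ length S → z ∈ S → ∃[ i ] z ∈ part p i S
  part-cover (c ∷ p) (x ∷ S) _ (here refl) = c , ∈-part-head c p x S
  part-cover (c ∷ p) (x ∷ S) eq (there z∈S) with part-cover p S (suc-injective eq) z∈S
  ... | i , z∈ with c F.≟ i
  ...   | yes refl = i , subst (_ ∈_) (sym (part-accept p x S refl)) (there z∈)
  ...   | no c≢i = i , subst (_ ∈_) (sym (part-reject p x S c≢i)) z∈

  part-∷-injective : ∀ c p q i x S → part (c ∷ p) i (x ∷ S) ≡ part (c ∷ q) i (x ∷ S) → part p i S ≡ part q i S
  part-∷-injective c p q i x S eq with c F.≟ i
  ... | yes _ = ∷-injectiveʳ eq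
  ... | no _ = eq

  part-injective : ∀ {p q S} → Linked _<_ S → length p ≡ length S → length q ≡ length S →
                   (∀ i → part p i S ≡ part q i S) → p ≡ q
  part-injective {[]} {[]} {[]} _ _ _ _ = refl
  part-injective {c ∷ p} {d ∷ q} {x ∷ S} l lp lq eq
    with part-disjoint (d ∷ q) l (∈-part-head d q x S) (subst (x ∈_) (eq c) (∈-part-head c p x S))
  ... | refl = cong (c ∷_) (part-injective (Linked.tail l) (suc-injective lp) (suc-injective lq)
                              (λ i → part-∷-injective c p q i x S (eq i)))

  count-↭ : ∀ {p q} i → p ↭ q → count i p ≡ count i q
  count-↭ i p↭q = ↭-length (filter-↭ (F._≟ i) p↭q)

  count-++ : ∀ i p q → count i (p ++ q) ≡ count i p + count i q
  count-++ i p q = trans (cong length (filter-++ (F._≟ i) p q)) (length-++ (filter (F._≟ i) p))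

  count-replicate-≢ : ∀ k {α i} → α ≢ i → count i (replicate k α) ≡ 0
  count-replicate-≢ k {i = i} α≢i = cong length (filter-none (F._≟ i) (All.replicate⁺ k α≢i))

  words : ℕ → List (List (Fin h))
  words zero = [] ∷ []
  words (suc k) = cartesianProductWith _∷_ (allFin h) (words k)

  ∈-words : ∀ {k p} → length p ≡ k → p ∈ words k
  ∈-words {zero} {[]} _ = here refl
  ∈-words {suc k} {c ∷ p} len = ∈-cartesianProductWith⁺ _∷_ (∈-allFin c) (∈-words (suc-injective len))

lookup-extensional : ∀ {n} {u v : Vec A n} → (∀ i → lookup u i ≡ lookup v i) → u ≡ v
lookup-extensional {u = u} {v} eq = trans (sym (tabulate∘lookup u)) (trans (tabulate-cong eq) (tabulate∘lookup v))

module _ {h : ℕ} where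

  Admissible : (Fin h → Family) → List (Fin h) → List ℕ → Set
  Admissible 𝒜 p S = ∀ i → 𝒜 i (part p i S)

  -- For sorted S, the words p of length |S| correspond to the representations (A₁,…,A_h) of S
  -- via Aᵢ = part p i S.
  parts : List (Fin h) → List ℕ → Vec (List ℕ) h
  parts p S = tabulate (λ i → part p i S)

  parts-IsRep : ∀ 𝒜 p S → Linked _<_ S → length p ≡ length S → Admissible 𝒜 p S → IsRep h 𝒜 S (parts p S)
  parts-IsRep 𝒜 p S l eq adm =
      (λ i → subst FinSubset (sym (lk i)) (Linked-resp-⊆ (part-⊆ p i S) l))
    , (λ i → subst (𝒜 i) (sym (lk i)) (adm i))
    , (λ i j i<j z z∈i z∈j →
         <-irrefl (cong toℕ (part-disjoint p l (subst (z ∈_) (lk i) z∈i) (subst (z ∈_) (lk j) z∈j))) i<j)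
    , λ z → (λ z∈S → let (i , z∈i) = part-cover p S eq z∈S in i , subst (z ∈_) (sym (lk i)) z∈i)
          , (λ i z∈i → ∈-part⁻ p i S (subst (z ∈_) (lk i) z∈i))
    where
    lk : ∀ i → lookup (parts p S) i ≡ part p i S
    lk = lookup∘tabulate (λ i → part p i S)

  g≥-fromWords : ∀ {n} 𝒜 S → Linked _<_ S → (d : Fin n → List (Fin h)) → Injective _≡_ _≡_ d →
                 (∀ a → length (d a) ≡ length S) → (∀ a → Admissible 𝒜 (d a) S) → g≥ h 𝒜 S n
  g≥-fromWords 𝒜 S l d d-inj len adm = (λ a → parts (d a) S) , parts-inj , λ a → parts-IsRep 𝒜 (d a) S l (len a) (adm a)
    where
    parts-inj : ∀ {a b} → parts (d a) S ≡ parts (d b) S → a ≡ b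
    parts-inj {a} {b} eq = d-inj (part-injective l (len a) (len b) λ i →
      trans (sym (lookup∘tabulate _ i)) (trans (cong (λ u → lookup u i) eq) (lookup∘tabulate _ i)))

  Covering : Vec (List ℕ) h → List ℕ → Set
  Covering u S = ∀ {z} → z ∈ S → ∃[ i ] z ∈ lookup u i

  colouring : ∀ u S → Covering u S → List (Fin h)
  colouring u [] _ = []
  colouring u (x ∷ S) cover = proj₁ (cover (here refl)) ∷ colouring u S (λ z∈S → cover (there z∈S))

  length-colouring : ∀ u S (cover : Covering u S) → length (colouring u S cover) ≡ length S
  length-colouring u [] _ = refl
  length-colouring u (x ∷ S) cover = cong suc (length-colouring u S _)

  ∈-part-colouring : ∀ u S (cover : Covering u S) {i z} → z ∈ part (colouring u S cover) i S → z ∈ lookup u i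
  ∈-part-colouring u (x ∷ S) cover {i} z∈ with proj₁ (cover (here refl)) F.≟ i | z∈
  ... | yes refl | here refl = proj₂ (cover (here refl))
  ... | yes refl | there z∈′ = ∈-part-colouring u S _ z∈′
  ... | no _ | z∈′ = ∈-part-colouring u S _ z∈′

  module _ (𝒜 : Fin h → Family) (S : List ℕ) (u : Vec (List ℕ) h) (rep : IsRep h 𝒜 S u) where

    private
      sorted = proj₁ rep
      disjoint = proj₁ (proj₂ (proj₂ rep))
      covers = proj₂ (proj₂ (proj₂ rep))

    repWord : List (Fin h)
    repWord = colouring u S (λ {z} → proj₁ (covers z))

    length-repWord : length repWord ≡ length S
    length-repWord = length-colouring u S _

    rep-unique : ∀ {i j z} → z ∈ lookup u i → z ∈ lookup u j → i ≡ j
    rep-unique {i} {j} {z} z∈i z∈j with F.<-cmp i j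
    ... | tri< i<j _ _ = ⊥-elim (disjoint i j i<j z z∈i z∈j)
    ... | tri≈ _ i≡j _ = i≡j
    ... | tri> _ _ j<i = ⊥-elim (disjoint j i j<i z z∈j z∈i)

    part-repWord : Linked _<_ S → ∀ i → part repWord i S ≡ lookup u i
    part-repWord l i = sorted-extensional (Linked-resp-⊆ (part-⊆ repWord i S) l) (sorted i) (∈-part-colouring u S _) ⊇
      where
      ⊇ : ∀ {z} → z ∈ lookup u i → z ∈ part repWord i S
      ⊇ {z} z∈i with part-cover repWord S length-repWord (proj₂ (covers z) i z∈i)
      ... | j , z∈j = subst (λ k → z ∈ part repWord k S) (rep-unique (∈-part-colouring u S _ z∈j) z∈i) z∈j

    repWord-admissible : Linked _<_ S → Admissible 𝒜 repWord S
    repWord-admissible l i = subst (𝒜 i) (sym (part-repWord l i)) (proj₁ (proj₂ rep) i)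

  record DistinctAdmissible (𝒜 : Fin h → Family) (S : List ℕ) (p q : List (Fin h)) : Set where
    field
      p-length : length p ≡ length S
      q-length : length q ≡ length S
      p≢q : p ≢ q
      p-admissible : Admissible 𝒜 p S
      q-admissible : Admissible 𝒜 q S

  g≥2⇒distinctAdmissible : ∀ {𝒜 S} → Linked _<_ S → g≥ h 𝒜 S 2 → Σ _ (uncurry (DistinctAdmissible 𝒜 S))
  g≥2⇒distinctAdmissible {𝒜} {S} l (t , t-inj , reps) = (word first , word second) , record
    { p-length = length-repWord 𝒜 S (t first) (reps first)
    ; q-length = length-repWord 𝒜 S (t second) (reps second)
    ; p≢q = distinct
    ; p-admissible = repWord-admissible 𝒜 S (t first) (reps first) l
    ; q-admissible = repWord-admissible 𝒜 S (t second) (reps second) l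
    }
    where
    first second : Fin 2
    first = F.zero
    second = F.suc F.zero
    word : Fin 2 → List (Fin h)
    word a = repWord 𝒜 S (t a) (reps a)
    distinct : word first ≢ word second
    distinct eq with t-inj (lookup-extensional λ i → trans (sym (part-repWord 𝒜 S (t first) (reps first) l i))
                              (trans (cong (λ p → part p i S) eq) (part-repWord 𝒜 S (t second) (reps second) l i)))
    ... | ()

-- Rearrangements of words

AnagramFamily : ℕ → List A → Set
AnagramFamily n r = Σ (Fin n → List _) λ d → Injective _≡_ _≡_ d × ∀ a → d a ↭ r

AnagramFamily-resp-↭ : ∀ {n} {r s : List A} → r ↭ s → AnagramFamily n r → AnagramFamily n s
AnagramFamily-resp-↭ r↭s (d , d-inj , d↭r) = d , d-inj , λ a → ↭-trans (d↭r a) r↭s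

∉-∷ : ∀ {α c : A} {V} → α ≢ c → α ∉ V → α ∉ c ∷ V
∉-∷ α≢c _ (here α≡c) = α≢c α≡c
∉-∷ _ α∉V (there α∈V) = α∉V α∈V

∉-replicate : ∀ {α β : A} k → α ≢ β → α ∉ replicate k β
∉-replicate k α≢β α∈ = All.lookup {P = _ ≢_} (All.replicate⁺ k α≢β) α∈ refl

↭-replicate : ∀ {α : A} {xs} k → xs ↭ replicate k α → xs ≡ replicate (length xs) α
↭-replicate {α = α} k xs↭ = all≡ (All-resp-↭ (↭-sym xs↭) (All.replicate⁺ k refl))
  where
  all≡ : ∀ {xs} → All (_≡ α) xs → xs ≡ replicate (length xs) α
  all≡ [] = refl
  all≡ (refl ∷ xs≡) = cong (α ∷_) (all≡ xs≡)

++-cancel-marker : ∀ {x : A} xs xs′ {ys ys′} → x ∉ xs → x ∉ xs′ →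
                   xs ++ x ∷ ys ≡ xs′ ++ x ∷ ys′ → xs ≡ xs′
++-cancel-marker [] [] _ _ _ = refl
++-cancel-marker [] (_ ∷ _) _ x∉ eq = ⊥-elim (x∉ (here (∷-injectiveˡ eq)))
++-cancel-marker (_ ∷ _) [] x∉ _ eq = ⊥-elim (x∉ (here (sym (∷-injectiveˡ eq))))
++-cancel-marker (_ ∷ xs) (_ ∷ xs′) x∉ x∉′ eq =
  cong₂ _∷_ (∷-injectiveˡ eq) (++-cancel-marker xs xs′ (x∉ ∘′ there) (x∉′ ∘′ there) (∷-injectiveʳ eq))

insertAt : ℕ → A → List A → List A → List A
insertAt a x V W = take a V ++ x ∷ drop a V ++ W

insertAt-↭ : ∀ a (x : A) V W → insertAt a x V W ↭ x ∷ V ++ W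
insertAt-↭ a x V W = ↭-trans (shift x (take a V) (drop a V ++ W))
  (↭-prep x (↭-reflexive (trans (sym (++-assoc (take a V) (drop a V) W)) (cong (_++ W) (take++drop≡id a V)))))

-- Since x ∉ V, the position of the first x tells the insertions apart.
insertions : ∀ n (x : A) V W → x ∉ V → n ≤ suc (length V) → AnagramFamily n (x ∷ V ++ W)
insertions n x V W x∉V n≤ = (λ a → insertAt (toℕ a) x V W) , insertions-inj , λ a → insertAt-↭ (toℕ a) x V W
  where
  position : ∀ (a : Fin n) → length (take (toℕ a) V) ≡ toℕ a
  position a = trans (length-take (toℕ a) V) (m≤n⇒m⊓n≡m (≤-pred (≤-trans (toℕ<n a) n≤)))
  x∉take : ∀ (a : Fin n) → x ∉ take (toℕ a) V
  x∉take a = x∉V ∘′ Sublist.lookup (take-⊆ (toℕ a) V)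
  insertions-inj : ∀ {a b} → insertAt (toℕ a) x V W ≡ insertAt (toℕ b) x V W → a ≡ b
  insertions-inj {a} {b} eq = toℕ-injective (begin
    toℕ a                     ≡⟨ sym (position a) ⟩
    length (take (toℕ a) V)   ≡⟨ cong length (++-cancel-marker _ _ (x∉take a) (x∉take b) eq) ⟩
    length (take (toℕ b) V)   ≡⟨ position b ⟩
    toℕ b                     ∎)
    where open ≡-Reasoning

≤-half : ∀ {n a b} → n + n ≤ a + b → n ≤ a ⊎ n ≤ b
≤-half {n} {a} {b} le with n ≤? a | n ≤? b
... | yes n≤a | _ = inj₁ n≤a
... | no _ | yes n≤b = inj₂ n≤b
... | no n≰a | no n≰b = ⊥-elim (≤⇒≯ le (+-mono-< (≰⇒> n≰a) (≰⇒> n≰b)))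

-- Either move the leading α through the block β ∷ V, or move β through the block of α's:
-- one of the two blocks has length at least n.
anagrams : ∀ {n} {α β : A} K V → α ∉ β ∷ V → n + n ≤ length (replicate (suc K) α ++ β ∷ V) →
           AnagramFamily n (replicate (suc K) α ++ β ∷ V)
anagrams {n = n} {α} {β} K V α∉βV le
  with ≤-half (≤-trans le (≤-reflexive (trans (length-++ (replicate (suc K) α)) (+-comm _ (length (β ∷ V))))))
... | inj₁ n≤βV = AnagramFamily-resp-↭ (↭-prep α (++-comm (β ∷ V) (replicate K α)))
                    (insertions n α (β ∷ V) (replicate K α) α∉βV (m≤n⇒m≤1+n n≤βV))
... | inj₂ n≤αs = AnagramFamily-resp-↭ (↭-sym (shift β (replicate (suc K) α) V))
                    (insertions n β (replicate (suc K) α) V (∉-replicate (suc K) (α∉βV ∘′ here ∘′ sym))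
                                (m≤n⇒m≤1+n n≤αs))

module _ (_≟_ : DecidableEquality A) where

  gather : ∀ α (r : List A) → ∃[ K ] ∃[ V ] (α ∉ V × r ↭ replicate K α ++ V)
  gather α [] = 0 , [] , (λ ()) , ↭-refl
  gather α (c ∷ r) with gather α r | c ≟ α
  ... | K , V , α∉V , r↭ | yes refl = suc K , V , α∉V , ↭-prep c r↭
  ... | K , V , α∉V , r↭ | no c≢α =
    K , c ∷ V , ∉-∷ (c≢α ∘′ sym) α∉V , ↭-trans (↭-prep c r↭) (↭-sym (shift c (replicate K α) V))

  constant-or-anagrams : ∀ n (r : List A) → n + n ≤ length r → (∃[ α ] r ≡ replicate (length r) α) ⊎ AnagramFamily n r
  constant-or-anagrams zero [] _ = inj₂ ((λ ()) , (λ { {()} }) , λ ())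
  constant-or-anagrams n (α ∷ r) le with gather α r
  ... | K , [] , _ , r↭ = inj₁ (α , cong (α ∷_) (↭-replicate K (↭-trans r↭ (↭-reflexive (++-identityʳ _)))))
  ... | K , β ∷ V , α∉βV , r↭ =
    inj₂ (AnagramFamily-resp-↭ (↭-sym (↭-prep α r↭))
                                (anagrams K V α∉βV (≤-trans le (≤-reflexive (↭-length (↭-prep α r↭))))))

-- Ramsey's theorem

sum-map-mono-≤ : ∀ {f g : A → ℕ} → (∀ c → g c ≤ f c) → ∀ L → sum (map g L) ≤ sum (map f L)
sum-map-mono-≤ g≤f [] = z≤n
sum-map-mono-≤ g≤f (c ∷ L) = +-mono-≤ (g≤f c) (sum-map-mono-≤ g≤f L)

sum-map-mono-< : ∀ {f g : A → ℕ} {c₀ L} → (∀ c → g c ≤ f c) → g c₀ < f c₀ → c₀ ∈ L →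
                 sum (map g L) < sum (map f L)
sum-map-mono-< {L = _ ∷ L} g≤f g<f (here refl) = +-mono-<-≤ g<f (sum-map-mono-≤ g≤f L)
sum-map-mono-< {L = c ∷ _} g≤f g<f (there c₀∈L) = +-mono-≤-< (g≤f c) (sum-map-mono-< g≤f g<f c₀∈L)

module Ramsey {A C : Set} (_≟_ : DecidableEquality C) (colours : List C) where

  module Pigeonhole (Q : C → A → List A → Set) (Q-antitone : ∀ {c z T T′} → T′ ⊆ T → Q c z T → Q c z T′) where

    infixr 5 _∷_
    data Tagged : List A → Set where
      [] : Tagged []
      _∷_ : ∀ {z T} → (∃[ c ] c ∈ colours × Q c z T) → Tagged T → Tagged (z ∷ T)

    data Uniform (c : C) : List A → Set where
      [] : Uniform c []
      _∷_ : ∀ {z T} → Q c z T → Uniform c T → Uniform c (z ∷ T)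

    private
      lower : (C → ℕ) → C → ℕ → C → ℕ
      lower f c₀ q c with c ≟ c₀
      ... | yes _ = q
      ... | no _ = f c

      lower-≤ : ∀ {f c₀ q} → f c₀ ≡ suc q → ∀ c → lower f c₀ q c ≤ f c
      lower-≤ {c₀ = c₀} {q} eq c with c ≟ c₀
      ... | yes refl = subst (q ≤_) (sym eq) (n≤1+n q)
      ... | no _ = ≤-refl

      lower-< : ∀ {f c₀ q} → f c₀ ≡ suc q → lower f c₀ q c₀ < f c₀
      lower-< {c₀ = c₀} {q} eq with c₀ ≟ c₀
      ... | yes _ = subst (q <_) (sym eq) (n<1+n q)
      ... | no c₀≢c₀ = ⊥-elim (c₀≢c₀ refl)

    -- Keeping the head z, tagged c₀, uses up one unit of the budget f c₀.
    pigeonhole : ∀ (f : C → ℕ) Z → Tagged Z → sum (map f colours) < length Z →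
                 ∃[ c ] (c ∈ colours × ∃[ Z′ ] (Z′ ⊆ Z × f c < length Z′ × Uniform c Z′))
    pigeonhole f (z ∷ T) ((c₀ , c₀∈ , q) ∷ tags) lt with f c₀ in eq
    ... | zero = c₀ , c₀∈ , z ∷ [] , refl ∷ Sublist.minimum T , subst (_< 1) (sym eq) (s≤s z≤n) ,
                 Q-antitone (Sublist.minimum T) q ∷ []
    ... | suc k with pigeonhole (lower f c₀ k) T tags
                       (<-≤-trans (sum-map-mono-< (lower-≤ eq) (lower-< eq) c₀∈) (≤-pred lt))
    ...   | c , c∈ , Z′ , τ , len , uniform with c ≟ c₀
    ...     | yes refl = c , c∈ , z ∷ Z′ , refl ∷ τ , subst (_< suc (length Z′)) (sym eq) (s≤s len) ,
                         Q-antitone τ q ∷ uniform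
    ...     | no _ = c , c∈ , Z′ , z ∷ʳ τ , len , uniform

  Homogeneous : (List A → C) → ℕ → List A → C → Set
  Homogeneous col k Z c = ∀ S → S ⊆ Z → length S ≡ k → col S ≡ c

  RamseyProperty : ℕ → Set
  RamseyProperty k = ∀ ℓ → ∃[ N ] ∀ (col : List A → C) → (∀ S → col S ∈ colours) → ∀ Y → N ≤ length Y →
                     ∃[ Z ] (Z ⊆ Y × ℓ ≤ length Z × ∃[ c ] (c ∈ colours × Homogeneous col k Z c))

  module _ (k : ℕ) (ramsey-k : RamseyProperty k) where

    TailHomogeneous : (List A → C) → C → A → List A → Set
    TailHomogeneous col c z T = Homogeneous (λ S → col (z ∷ S)) k T c

    module PH (col : List A → C) = Pigeonhole (TailHomogeneous col) (λ τ hom S σ → hom S (⊆-trans σ τ))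

    endHomogeneous : ∀ L → ∃[ N ] ∀ (col : List A → C) → (∀ S → col S ∈ colours) → ∀ Y → N ≤ length Y →
                     ∃[ Z ] (Z ⊆ Y × L ≤ length Z × PH.Tagged col Z)
    endHomogeneous zero = 0 , λ col _ Y _ → [] , Sublist.minimum Y , z≤n , PH.[] {col = col}
    endHomogeneous (suc L) with endHomogeneous L
    ... | N , end-L with ramsey-k N
    ...   | N₁ , hom-k = suc N₁ , extend
      where
      extend : ∀ (col : List A → C) → (∀ S → col S ∈ colours) → ∀ Y → suc N₁ ≤ length Y →
               ∃[ Z ] (Z ⊆ Y × suc L ≤ length Z × PH.Tagged col Z)
      extend col col∈ (y ∷ Y) (s≤s N₁≤) with hom-k (λ S → col (y ∷ S)) (λ S → col∈ (y ∷ S)) Y N₁≤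
      ... | Z₁ , τ₁ , N≤ , c , c∈ , hom with end-L col col∈ Z₁ N≤
      ...   | Z₂ , τ₂ , L≤ , tags = y ∷ Z₂ , refl ∷ ⊆-trans τ₂ τ₁ , s≤s L≤ ,
                                   PH._∷_ {col = col} (c , c∈ , λ S σ → hom S (⊆-trans σ τ₂)) tags

    uniform⇒homogeneous : ∀ col {c Z} → PH.Uniform col c Z → Homogeneous col (suc k) Z c
    uniform⇒homogeneous col (_ PH.∷ uniform) S (_ ∷ʳ τ) len = uniform⇒homogeneous col uniform S τ len
    uniform⇒homogeneous col (hom PH.∷ _) (_ ∷ S) (refl ∷ τ) len = hom S τ (suc-injective len)

    ramsey-suc : RamseyProperty (suc k)
    ramsey-suc ℓ with endHomogeneous (suc (sum (map (λ _ → ℓ) colours)))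
    ... | N , end = N , homogeneous
      where
      homogeneous : ∀ (col : List A → C) → (∀ S → col S ∈ colours) → ∀ Y → N ≤ length Y →
                    ∃[ Z ] (Z ⊆ Y × ℓ ≤ length Z × ∃[ c ] (c ∈ colours × Homogeneous col (suc k) Z c))
      homogeneous col col∈ Y N≤ with end col col∈ Y N≤
      ... | Z , τ , len , tags with PH.pigeonhole col (λ _ → ℓ) Z tags len
      ...   | c , c∈ , Z′ , τ′ , ℓ< , uniform =
        Z′ , ⊆-trans τ′ τ , <⇒≤ ℓ< , c , c∈ , uniform⇒homogeneous col uniform

  ramsey : ∀ k → RamseyProperty k
  ramsey zero ℓ = ℓ , λ col col∈ Y ℓ≤ → Y , ⊆-refl , ℓ≤ , col [] , col∈ [] , λ { [] _ _ → refl }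
  ramsey (suc k) = ramsey-suc k (ramsey k)

-- Spread-out sublists

data Spaced {A : Set} (g : ℕ) : List A → List A → Set where
  end : ∀ {F} → g ≤ length F → Spaced g [] F
  gap : ∀ {F t T Z} → g ≤ length F → Spaced g T Z → Spaced g (t ∷ T) (F ++ t ∷ Z)

module _ {g : ℕ} where

  Spaced-weaken : ∀ {g′} {T Z : List A} → g′ ≤ g → Spaced g T Z → Spaced g′ T Z
  Spaced-weaken g′≤g (end g≤F) = end (≤-trans g′≤g g≤F)
  Spaced-weaken g′≤g (gap g≤F sp) = gap (≤-trans g′≤g g≤F) (Spaced-weaken g′≤g sp)

  Spaced-++ˡ : ∀ {T Z : List A} G → Spaced g T Z → Spaced g T (G ++ Z)
  Spaced-++ˡ G (end g≤F) = end (≤-trans g≤F (length-mono-≤ (++⁺ˡ G ⊆-refl)))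
  Spaced-++ˡ G (gap {F} {t} {T} {Z} g≤F sp) =
    subst (Spaced g (t ∷ T)) (++-assoc G F (t ∷ Z)) (gap (≤-trans g≤F (length-mono-≤ (++⁺ˡ G ⊆-refl))) sp)

  Spaced-resp-⊆ : ∀ {Q T Z : List A} → Q ⊆ T → Spaced g T Z → Spaced g Q Z
  Spaced-resp-⊆ [] sp = sp
  Spaced-resp-⊆ (_∷ʳ_ t Q⊆T) (gap {F} {Z = Z} _ sp) =
    subst (Spaced g _) (++-assoc F (t ∷ []) Z) (Spaced-++ˡ (F ++ t ∷ []) (Spaced-resp-⊆ Q⊆T sp))
  Spaced-resp-⊆ (refl ∷ Q⊆T) (gap g≤F sp) = gap g≤F (Spaced-resp-⊆ Q⊆T sp)

  Spaced⇒⊆ : ∀ {T Z : List A} → Spaced g T Z → T ⊆ Z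
  Spaced⇒⊆ (end {F} _) = Sublist.minimum F
  Spaced⇒⊆ (gap {F} _ sp) = ++⁺ˡ F (refl ∷ Spaced⇒⊆ sp)

split-head : ∀ {g} (F : List A) → suc g ≤ length F → ∃[ z ] ∃[ F′ ] (F ≡ z ∷ F′ × g ≤ length F′)
split-head (z ∷ F) (s≤s g≤F) = z , F , refl , g≤F

Spaced-uncons : ∀ {g} {T Z : List A} → Spaced (suc g) T Z → ∃[ z ] ∃[ Z′ ] (Z ≡ z ∷ Z′ × Spaced g T Z′)
Spaced-uncons (end {F} g<F) with split-head F g<F
... | z , F′ , refl , g≤F′ = z , F′ , refl , end g≤F′
Spaced-uncons (gap {F} g<F sp) with split-head F g<F
... | z , F′ , refl , g≤F′ = z , _ , refl , gap g≤F′ (Spaced-weaken (n≤1+n _) sp)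

split-around : ∀ g {k} (Z : List A) → suc g + k ≤ length Z →
               ∃[ F ] ∃[ t ] ∃[ Z′ ] (Z ≡ F ++ t ∷ Z′ × g ≤ length F × k ≤ length Z′)
split-around zero (t ∷ Z′) (s≤s k≤) = [] , t , Z′ , refl , z≤n , k≤
split-around (suc g) (z ∷ Z) (s≤s le) with split-around g Z le
... | F , t , Z′ , refl , g≤F , k≤ = z ∷ F , t , Z′ , refl , s≤s g≤F , k≤

spaced-sublist : ∀ g L (Z : List A) → L * suc g + g ≤ length Z → ∃[ T ] (length T ≡ L × Spaced g T Z)
spaced-sublist g zero Z g≤ = [] , refl , end g≤
spaced-sublist g (suc L) Z le with split-around g Z (≤-trans (≤-reflexive (sym (+-assoc (suc g) (L * suc g) g))) le)
... | F , t , Z′ , refl , g≤F , le′ with spaced-sublist g L Z′ le′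
...   | T , refl , sp = t ∷ T , refl , gap g≤F sp

Full : Family → List ℕ → ℕ → Set
Full 𝒜 T k = ∀ Q → Q ⊆ T → length Q ≡ k → 𝒜 Q

module _ {h : ℕ} where

  -- The letters of p other than i are placed in the gaps of Z, which are long enough as |p| ≤ g.
  realise : ∀ {g Q Z} p (i : Fin h) → Spaced g Q Z → length p ≤ g → length Q ≡ count i p →
            ∃[ S ] (S ⊆ Z × length S ≡ length p × part p i S ≡ Q)
  realise {Q = []} {Z} [] i _ _ _ = [] , Sublist.minimum Z , refl , refl
  realise (c ∷ p) i sp le len with c F.≟ i
  realise (c ∷ p) i (gap {F} _ sp) le len | yes c≡i with realise p i sp (≤-trans (n≤1+n _) le) (suc-injective len)
  ... | S , S⊆Z , lenS , partS =
    _ ∷ S , ++⁺ˡ F (refl ∷ S⊆Z) , cong suc lenS , trans (part-accept p _ S c≡i) (cong (_ ∷_) partS)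
  realise (c ∷ p) i sp (s≤s le) len | no c≢i with Spaced-uncons sp
  ... | z , Z′ , refl , sp′ with realise p i sp′ le len
  ...   | S , S⊆Z′ , lenS , partS = z ∷ S , refl ∷ S⊆Z′ , cong suc lenS , trans (part-reject p z S c≢i) partS

  spaced-full : ∀ {g T Z} (𝒜 : Fin h → Family) p → Spaced g T Z → length p ≤ g →
                (∀ S → S ⊆ Z → length S ≡ length p → Admissible 𝒜 p S) → ∀ i → Full (𝒜 i) T (count i p)
  spaced-full 𝒜 p sp p≤g admissible i Q Q⊆T lenQ with realise p i (Spaced-resp-⊆ Q⊆T sp) p≤g lenQ
  ... | S , S⊆Z , lenS , partS = subst (𝒜 i) partS (admissible S S⊆Z lenS i)

  full⇒admissible : ∀ {T S} (𝒜 : Fin h → Family) p → S ⊆ T → length p ≡ length S →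
                    (∀ i → Full (𝒜 i) T (count i p)) → Admissible 𝒜 p S
  full⇒admissible 𝒜 p S⊆T len full i = full i (part p i _) (⊆-trans (part-⊆ p i _) S⊆T) (length-part p i _ len)

  anagrams⇒g≥ : ∀ {n T} (𝒜 : Fin h → Family) r → Linked _<_ T → length r ≤ length T →
                (∀ i → Full (𝒜 i) T (count i r)) → AnagramFamily n r → ∃[ S ] (FinSubset S × g≥ h 𝒜 S n)
  anagrams⇒g≥ {T = T} 𝒜 r T-sorted r≤T full (d , d-inj , d↭r) =
    S , S-sorted , g≥-fromWords 𝒜 S S-sorted d d-inj len (λ a → full⇒admissible 𝒜 (d a) S⊆T (len a) (full-d a))
    where
    S = take (length r) T
    S⊆T = take-⊆ (length r) T
    S-sorted = Linked-resp-⊆ S⊆T T-sorted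
    len : ∀ a → length (d a) ≡ length S
    len a = trans (↭-length (d↭r a)) (sym (trans (length-take (length r) T) (m≤n⇒m⊓n≡m r≤T)))
    full-d : ∀ a i → Full (𝒜 i) T (count i (d a))
    full-d a i = subst (Full (𝒜 i) T) (sym (count-↭ i (d↭r a))) (full i)

  replicate-full : ∀ {T} (𝒜 : Fin h → Family) a b {α β : Fin h} → α ≢ β →
                   (∀ i → Full (𝒜 i) T (count i (replicate a α))) →
                   (∀ i → Full (𝒜 i) T (count i (replicate b β))) →
                   ∀ i → Full (𝒜 i) T (count i (replicate a α ++ replicate b β))
  replicate-full {T} 𝒜 a b {α} {β} α≢β α-full β-full i with α F.≟ i
  ... | yes refl = subst (Full (𝒜 α) T) (sym (begin
      count α (replicate a α ++ replicate b β)          ≡⟨ count-++ α (replicate a α) _ ⟩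
      count α (replicate a α) + count α (replicate b β) ≡⟨ cong (_ +_) (count-replicate-≢ b (α≢β ∘′ sym)) ⟩
      count α (replicate a α) + 0                       ≡⟨ +-identityʳ _ ⟩
      count α (replicate a α)                           ∎)) (α-full α)
    where open ≡-Reasoning
  ... | no α≢i =
    subst (Full (𝒜 i) T) (sym (trans (count-++ i (replicate a α) _) (cong (_+ _) (count-replicate-≢ a α≢i)))) (β-full i)

-- (m + m) * suc m + m is what spaced-sublist needs for 2m elements separated by gaps of m.
module _ {h : ℕ} (𝒜 : Fin h → Family) {n k : ℕ} (2n≤m : n + n ≤ suc k) {Z : List ℕ} {p q : List (Fin h)}
         (Z-sorted : Linked _<_ Z) (ℓ≤Z : (suc k + suc k) * suc (suc k) + suc k ≤ length Z)
         (distinct : ∀ S → S ⊆ Z → length S ≡ suc k → DistinctAdmissible 𝒜 S p q) where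

  private
    m = suc k

    S₀-length : length (take m Z) ≡ m
    S₀-length = trans (length-take m Z) (m≤n⇒m⊓n≡m (≤-trans (m≤n+m m ((m + m) * suc m)) ℓ≤Z))

    distinct₀ : DistinctAdmissible 𝒜 (take m Z) p q
    distinct₀ = distinct (take m Z) (take-⊆ m Z) S₀-length

    p-length : length p ≡ m
    p-length = trans (DistinctAdmissible.p-length distinct₀) S₀-length

    q-length : length q ≡ m
    q-length = trans (DistinctAdmissible.q-length distinct₀) S₀-length

    2n≤ : ∀ (w : List (Fin h)) → length w ≡ m → n + n ≤ length w
    2n≤ w w-length = ≤-trans 2n≤m (≤-reflexive (sym w-length))

    T-sorted : ∀ {T} → Spaced m T Z → Linked _<_ T
    T-sorted sp = Linked-resp-⊆ (Spaced⇒⊆ sp) Z-sorted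

    m≤T : ∀ (T : List ℕ) → length T ≡ m + m → m ≤ length T
    m≤T T T-length = ≤-trans (m≤m+n m m) (≤-reflexive (sym T-length))

    full : ∀ {T} w → Spaced m T Z → length w ≡ m → (∀ S → S ⊆ Z → length S ≡ m → Admissible 𝒜 w S) →
           ∀ i → Full (𝒜 i) T (count i w)
    full w sp w-length admissible =
      spaced-full 𝒜 w sp (≤-reflexive w-length) λ S S⊆Z lenS → admissible S S⊆Z (trans lenS w-length)

    p-full : ∀ {T} → Spaced m T Z → ∀ i → Full (𝒜 i) T (count i p)
    p-full sp = full p sp p-length λ S S⊆Z lenS → DistinctAdmissible.p-admissible (distinct S S⊆Z lenS)

    q-full : ∀ {T} → Spaced m T Z → ∀ i → Full (𝒜 i) T (count i q)
    q-full sp = full q sp q-length λ S S⊆Z lenS → DistinctAdmissible.q-admissible (distinct S S⊆Z lenS)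

    constant-full : ∀ {T w α} → w ≡ replicate (length w) α → length w ≡ m →
                    (∀ i → Full (𝒜 i) T (count i w)) → ∀ i → Full (𝒜 i) T (count i (replicate m α))
    constant-full {T} {α = α} w≡ w-length =
      subst (λ w → ∀ i → Full (𝒜 i) T (count i w)) (trans w≡ (cong (λ l → replicate l α) w-length))

    Constant : List (Fin h) → Set
    Constant w = ∃[ α ] w ≡ replicate (length w) α

    from-spaced : ∀ {T} → Spaced m T Z → length T ≡ m + m →
                  Constant p ⊎ AnagramFamily n p → Constant q ⊎ AnagramFamily n q → ∃[ S ] (FinSubset S × g≥ h 𝒜 S n)
    from-spaced {T} sp T-length (inj₂ p-anagrams) _ =
      anagrams⇒g≥ 𝒜 p (T-sorted sp) (≤-trans (≤-reflexive p-length) (m≤T T T-length)) (p-full sp) p-anagrams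
    from-spaced {T} sp T-length (inj₁ _) (inj₂ q-anagrams) =
      anagrams⇒g≥ 𝒜 q (T-sorted sp) (≤-trans (≤-reflexive q-length) (m≤T T T-length)) (q-full sp) q-anagrams
    from-spaced {T} sp T-length (inj₁ (α , p≡)) (inj₁ (β , q≡)) =
      anagrams⇒g≥ 𝒜 (replicate m α ++ replicate m β) (T-sorted sp) (≤-reflexive (trans r-length (sym T-length)))
        (replicate-full 𝒜 m m α≢β (constant-full p≡ p-length (p-full sp)) (constant-full q≡ q-length (q-full sp)))
        (anagrams k (replicate k β) (∉-replicate m α≢β) (≤-trans 2n≤m (≤-trans (m≤m+n m m) (≤-reflexive (sym r-length)))))
      where
      r-length : length (replicate m α ++ replicate m β) ≡ m + m
      r-length = trans (length-++ (replicate m α)) (cong₂ _+_ (length-replicate m) (length-replicate m))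
      α≢β : α ≢ β
      α≢β refl = DistinctAdmissible.p≢q distinct₀
        (trans p≡ (trans (cong (λ l → replicate l α) (trans p-length (sym q-length))) (sym q≡)))

  homogeneous⇒g≥ : ∃[ S ] (FinSubset S × g≥ h 𝒜 S n)
  homogeneous⇒g≥ with spaced-sublist m (m + m) Z ℓ≤Z
  ... | T , T-length , sp = from-spaced sp T-length (constant-or-anagrams F._≟_ n p (2n≤ p p-length))
                                                   (constant-or-anagrams F._≟_ n q (2n≤ q q-length))

module _ {h : ℕ} (𝒜 : Fin h → Family) (α₀ : Fin h) {m : ℕ} (0<m : 0 < m) (E : List (List ℕ))
         (almostAll : ∀ S → InLayer m S → S ∉ E → g≥ h 𝒜 S 2) where

  private
    bound : ℕ
    bound = max 0 (concat E)

    Valid : List ℕ → Set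
    Valid S = Linked _<_ S × length S ≡ m × All (bound <_) S

    valid? : ∀ S → Dec (Valid S)
    valid? S = linked? _<?_ S ×-dec (length S ℕ.≟ m ×-dec All.all? (bound <?_) S)

    valid∉E : ∀ {S} → Valid S → S ∉ E
    valid∉E {[]} (_ , len , _) _ = <-irrefl len 0<m
    valid∉E {x ∷ S} (_ , _ , bound<x ∷ _) S∈E =
      <⇒≱ bound<x (All.lookup (xs≤max 0 (concat E)) (∈-concat⁺′ (here refl) S∈E))

    distinct : ∀ {S} → Valid S → Σ _ (uncurry (DistinctAdmissible 𝒜 S))
    distinct {S} v@(sorted , len , _) = g≥2⇒distinctAdmissible sorted (almostAll S (sorted , len) (valid∉E v))

    Colour : Set
    Colour = List (Fin h) × List (Fin h)

    colours : List Colour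
    colours = cartesianProduct (words m) (words m)

    -- Invalid sets get an arbitrary colour; they never lie inside the homogeneous set.
    colour : List ℕ → Colour
    colour S with valid? S
    ... | yes v = proj₁ (distinct v)
    ... | no _ = replicate m α₀ , replicate m α₀

    colour-valid : ∀ {S} → Valid S → uncurry (DistinctAdmissible 𝒜 S) (colour S)
    colour-valid {S} v with valid? S
    ... | yes v′ = proj₂ (distinct v′)
    ... | no ¬v = ⊥-elim (¬v v)

    colour∈ : ∀ S → colour S ∈ colours
    colour∈ S with valid? S
    ... | yes v@(_ , len , _) = ∈-cartesianProduct⁺ (∈-words (trans (DistinctAdmissible.p-length (proj₂ (distinct v))) len))
                                                    (∈-words (trans (DistinctAdmissible.q-length (proj₂ (distinct v))) len))
    ... | no _ = ∈-cartesianProduct⁺ (∈-words (length-replicate m)) (∈-words (length-replicate m))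

    open Ramsey {A = ℕ} (Σ.≡-dec (List.≡-dec F._≟_) (List.≡-dec F._≟_)) colours

  homogeneous-set : ∀ ℓ → ∃[ Z ] ∃[ p ] ∃[ q ]
                    (Linked _<_ Z × ℓ ≤ length Z × ∀ S → S ⊆ Z → length S ≡ m → DistinctAdmissible 𝒜 S p q)
  homogeneous-set ℓ with ramsey m ℓ
  ... | N , homogeneous with homogeneous colour colour∈ (applyUpTo (_+ suc bound) N) (≤-reflexive (sym (length-applyUpTo _ N)))
  ...   | Z , Z⊆Y , ℓ≤Z , (p , q) , _ , hom =
    Z , p , q , Linked-resp-⊆ Z⊆Y Y-sorted , ℓ≤Z ,
    λ S S⊆Z lenS → let S⊆Y = ⊆-trans S⊆Z Z⊆Y in
      subst (uncurry (DistinctAdmissible 𝒜 S)) (hom S S⊆Z lenS)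
            (colour-valid (Linked-resp-⊆ S⊆Y Y-sorted , lenS , All-resp-⊆ S⊆Y Y-above))
    where
    Y-sorted : Linked _<_ (applyUpTo (_+ suc bound) N)
    Y-sorted = Linked.applyUpTo⁺₂ (_+ suc bound) N (λ i → n<1+n (i + suc bound))
    Y-above : All (bound <_) (applyUpTo (_+ suc bound) N)
    Y-above = All.applyUpTo⁺₂ (_+ suc bound) N (λ i → m≤n+m (suc bound) i)

theorem8 : (h : ℕ) → h ≥ 2 → (𝒜 : Fin h → Family) → (W : ℕ → Set) → (∀ n → W n → 0 < n) → Infinite W → (∀ n → W n → AlmostAllLayer≥2 h 𝒜 n) → ∀ n → ∃[ S ] (FinSubset S × g≥ h 𝒜 S n)
theorem8 h h≥2 𝒜 W W-positive W-infinite W-almostAll n with W-infinite (n + n)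
... | m , 2n≤m , m∈W with W-positive m m∈W | W-almostAll m m∈W
...   | 0<m@(s≤s _) | E , almostAll with homogeneous-set 𝒜 α₀ 0<m E almostAll ((m + m) * suc m + m)
  where
  α₀ : Fin h
  α₀ = F.fromℕ< (≤-trans (s≤s z≤n) h≥2)
...     | Z , p , q , Z-sorted , ℓ≤Z , distinct = homogeneous⇒g≥ 𝒜 2n≤m Z-sorted ℓ≤Z distinct
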